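{- Let $G$ be a simple connected unicyclic graph with minimum degree $1$ that is 2-walk $(a,b)$-parabolic, and let $G_0$ be the graph obtained from $G$ by deleting all pendant vertices. Then for every $v\in V(G_0)$, either $d(v)=d_{G_0}(v)$ or $d(v)=a-b-1$.
   Context: $d(v)$ denotes the degree of $v$ in $G$ and $d_{G_0}(v)$ its degree in $G_0$; $s(v)=\sum_{u\in N_G(v)}d(u)$. $G$ is called 2-walk $(a,b)$-parabolic if there is exactly one pair $(a,b)$ with $a$ a positive integer and $b$ a non-negative integer satisfying $a^2-8b>0$ such that $s(v)=-d(v)^2+a\,d(v)-b$ for every vertex $v\in V(G)$. A pendant vertex is a vertex of degree $1$. -}

module Defs where

open import Data.Nat using (ℕ; zero; suc; _+_; _*_; _≤_; _<_; _^_)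
open import Data.Nat.Properties using (_<?_)
open import Data.Fin using (Fin; toℕ)
open import Data.List using (List; map; allFin)
open import Data.Nat.ListAction using (sum)
open import Data.Bool using (Bool; true; false; if_then_else_; T)
open import Data.Product using (_×_; Σ; ∃)
open import Relation.Nullary using (¬_; does)
open import Relation.Binary.PropositionalEquality using (_≡_)
open import Relation.Binary.Construct.Closure.ReflexiveTransitive using (Star)

record Graph (n : ℕ) : Set where
  field
    adj   : Fin n → Fin n → Bool
    sym   : ∀ u v → adj u v ≡ adj v u
    irrefl : ∀ v → adj v v ≡ false
open Graph public

Adj : ∀ {n} → Graph n → Fin n → Fin n → Set
Adj G u v = T (adj G u v)

sumNbr : ∀ {n} → Graph n → Fin n → (Fin n → ℕ) → ℕ
sumNbr G v f = sum (map (λ u → if adj G v u then f u else 0) (allFin _))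

deg : ∀ {n} → Graph n → Fin n → ℕ
deg G v = sumNbr G v (λ _ → 1)

s : ∀ {n} → Graph n → Fin n → ℕ
s G v = sumNbr G v (deg G)

Pendant : ∀ {n} → Graph n → Fin n → Set
Pendant G v = deg G v ≡ 1

-- d_{G₀}(v): degree of v in G₀ = G minus all pendant vertices,
-- i.e. the number of non-pendant neighbours of v in G.
deg₀ : ∀ {n} → Graph n → Fin n → ℕ
deg₀ G v = sumNbr G v (λ u → if does (deg G u Data.Nat.≟ 1) then 0 else 1)
  where import Data.Nat

edgeCount : ∀ {n} → Graph n → ℕ
edgeCount {n} G =
  sum (map (λ i → sum (map (λ j →
        if does (toℕ i <? toℕ j) then (if adj G i j then 1 else 0) else 0)
      (allFin n))) (allFin n))

Connected : ∀ {n} → Graph n → Set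
Connected G = ∀ u v → Star (Adj G) u v

-- unicyclic: connected with exactly as many edges as vertices
-- (equivalently: connected with exactly one cycle)
Unicyclic : ∀ {n} → Graph n → Set
Unicyclic {n} G = Connected G × edgeCount G ≡ n

MinDegreeOne : ∀ {n} → Graph n → Set
MinDegreeOne G = (∀ v → 1 ≤ deg G v) × ∃ (λ v → deg G v ≡ 1)

-- (a,b) with a ≥ 1, b ≥ 0, a² − 8b > 0 and s(v) = −d(v)² + a d(v) − b for all v.
-- The identity is stated in ℕ as s(v) + d(v)² + b = a·d(v), which is the
-- same integer equation rearranged (all terms are natural numbers).
ParabolicPair : ∀ {n} → Graph n → ℕ → ℕ → Set
ParabolicPair G a b =
  (1 ≤ a) × (8 * b < a ^ 2) ×
  (∀ v → s G v + deg G v ^ 2 + b ≡ a * deg G v)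

TwoWalkParabolic : ∀ {n} → Graph n → ℕ → ℕ → Set
TwoWalkParabolic G a b =
  ParabolicPair G a b ×
  (∀ a' b' → ParabolicPair G a' b' → (a' ≡ a) × (b' ≡ b))

{-# OPTIONS --safe #-}
-- If d(v) ≠ d_{G₀}(v) then v has a pendant neighbour u. Since u has v as its
-- only neighbour, s(u) = d(v), and the parabolic identity at u reads
-- d(v) + 1 + b = a.
module Submission where

open import Defs hiding (sym)
open import Data.Nat using (ℕ; zero; suc; _+_; _*_; _^_; _≟_; pred)
open import Data.Nat.Properties using (+-identityʳ; *-identityʳ)
open import Data.Fin using (Fin)
open import Data.Integer using (ℤ; +_; _-_)
import Data.Integer as ℤ
open import Data.Integer.Properties using (pos-+)
open import Data.Integer.Tactic.RingSolver using (solve-∀)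
open import Data.Sum using (_⊎_; inj₁; inj₂)
open import Data.Product using (_×_; _,_; ∃)
open import Data.Bool using (Bool; true; false; if_then_else_)
open import Data.List using (List; []; _∷_; map; allFin)
open import Data.Nat.ListAction using (sum)
open import Data.List.Relation.Unary.Any using (here; there)
open import Data.List.Membership.Propositional using (_∈_)
open import Data.List.Membership.Propositional.Properties using (∈-allFin)
open import Relation.Nullary using (¬_; yes; no; does)
open import Relation.Binary.PropositionalEquality
  using (_≡_; _≢_; refl; sym; trans; cong; cong₂; module ≡-Reasoning)
open import Data.Empty using (⊥-elim)

sum-map-≢⇒∃≢ : ∀ {A : Set} (f g : A → ℕ) (xs : List A) →
  sum (map f xs) ≢ sum (map g xs) → ∃ λ x → f x ≢ g x
sum-map-≢⇒∃≢ f g []       ne = ⊥-elim (ne refl)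
sum-map-≢⇒∃≢ f g (x ∷ xs) ne with f x ≟ g x
... | no  fx≢gx = x , fx≢gx
... | yes fx≡gx = sum-map-≢⇒∃≢ f g xs (λ eq → ne (cong₂ _+_ fx≡gx eq))

sumWhen : ∀ {A : Set} → (A → Bool) → (A → ℕ) → List A → ℕ
sumWhen p f xs = sum (map (λ x → if p x then f x else 0) xs)

countWhen : ∀ {A : Set} → (A → Bool) → List A → ℕ
countWhen p = sumWhen p (λ _ → 1)

countWhen≡0⇒sumWhen≡0 : ∀ {A : Set} (p : A → Bool) (f : A → ℕ) xs →
  countWhen p xs ≡ 0 → sumWhen p f xs ≡ 0
countWhen≡0⇒sumWhen≡0 p f []       _ = refl
countWhen≡0⇒sumWhen≡0 p f (x ∷ xs) c≡0 with p x
... | false = countWhen≡0⇒sumWhen≡0 p f xs c≡0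
countWhen≡0⇒sumWhen≡0 p f (x ∷ xs) () | true

countWhen≢0 : ∀ {A : Set} (p : A → Bool) {y : A} xs →
  p y ≡ true → y ∈ xs → countWhen p xs ≢ 0
countWhen≢0 p (x ∷ xs) py (here refl) rewrite py = λ ()
countWhen≢0 p (x ∷ xs) py (there y∈xs) with p x
... | true  = λ ()
... | false = countWhen≢0 p xs py y∈xs

countWhen≡1⇒sumWhen≡ : ∀ {A : Set} (p : A → Bool) (f : A → ℕ) {y : A} xs →
  p y ≡ true → y ∈ xs → countWhen p xs ≡ 1 → sumWhen p f xs ≡ f y
countWhen≡1⇒sumWhen≡ p f {y} (x ∷ xs) py (here refl) c≡1 rewrite py =
  trans (cong (λ k → f y + k) (countWhen≡0⇒sumWhen≡0 p f xs (cong pred c≡1)))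
        (+-identityʳ (f y))
countWhen≡1⇒sumWhen≡ p f (x ∷ xs) py (there y∈xs) c≡1 with p x
... | true  = ⊥-elim (countWhen≢0 p xs py y∈xs (cong pred c≡1))
... | false = countWhen≡1⇒sumWhen≡ p f xs py y∈xs c≡1

sumNbr-pendant : ∀ {n} (G : Graph n) {u v : Fin n} (f : Fin n → ℕ) →
  Pendant G u → adj G u v ≡ true → sumNbr G u f ≡ f v
sumNbr-pendant {n} G {v = v} f pendant uv =
  countWhen≡1⇒sumWhen≡ (adj G _) f (allFin n) uv (∈-allFin v) pendant

s-pendant : ∀ {n} (G : Graph n) {u v : Fin n} →
  Pendant G u → adj G v u ≡ true → s G u ≡ deg G v
s-pendant G {u} {v} pendant vu =
  sumNbr-pendant G (deg G) pendant (trans (sym (Graph.sym G v u)) vu)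

nonPendantIndicator≢1⇒≡1 : ∀ k → 1 ≢ (if does (k ≟ 1) then 0 else 1) → k ≡ 1
nonPendantIndicator≢1⇒≡1 zero          ne = ⊥-elim (ne refl)
nonPendantIndicator≢1⇒≡1 (suc zero)    _  = refl
nonPendantIndicator≢1⇒≡1 (suc (suc k)) ne = ⊥-elim (ne refl)

deg≢deg₀⇒pendantNeighbour : ∀ {n} (G : Graph n) (v : Fin n) →
  deg G v ≢ deg₀ G v → ∃ λ u → adj G v u ≡ true × Pendant G u
deg≢deg₀⇒pendantNeighbour {n} G v ne with sum-map-≢⇒∃≢ _ _ (allFin n) ne
... | u , differ with adj G v u in vu
... | false = ⊥-elim (differ refl)
... | true  = u , vu , nonPendantIndicator≢1⇒≡1 (deg G u) differ

parabolic-pendant : ∀ {n} (G : Graph n) {a b : ℕ} {u : Fin n} →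
  (∀ v → s G v + deg G v ^ 2 + b ≡ a * deg G v) →
  Pendant G u → s G u + 1 + b ≡ a
parabolic-pendant G {a} {b} {u} identity pendant = begin
  s G u + 1 + b                ≡⟨ cong (λ k → s G u + k ^ 2 + b) (sym pendant) ⟩
  s G u + deg G u ^ 2 + b      ≡⟨ identity u ⟩
  a * deg G u                  ≡⟨ cong (a *_) pendant ⟩
  a * 1                        ≡⟨ *-identityʳ a ⟩
  a                            ∎
  where open ≡-Reasoning

+[m+1+n]-+n-+1≡+m : ∀ m n → + (m + 1 + n) - + n - + 1 ≡ + m
+[m+1+n]-+n-+1≡+m m n =
  trans (cong (λ k → k - + n - + 1)
              (trans (pos-+ (m + 1) n) (cong (ℤ._+ + n) (pos-+ m 1))))
        (x+1+y-y-1≡x (+ m) (+ n))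
  where
  x+1+y-y-1≡x : ∀ (x y : ℤ) → x ℤ.+ + 1 ℤ.+ y - y - + 1 ≡ x
  x+1+y-y-1≡x = solve-∀

lemma8 : ∀ {n} (G : Graph n) (a b : ℕ) →
    Unicyclic G → MinDegreeOne G → TwoWalkParabolic G a b →
    ∀ (v : Fin n) → ¬ Pendant G v →
    (deg G v ≡ deg₀ G v) ⊎ (+ deg G v ≡ + a - + b - + 1)
lemma8 G a b _ _ ((_ , _ , identity) , _) v _ with deg G v ≟ deg₀ G v
... | yes d≡d₀ = inj₁ d≡d₀
... | no  d≢d₀ with deg≢deg₀⇒pendantNeighbour G v d≢d₀
... | u , vu , pendant = inj₂ (begin
  + deg G v                          ≡⟨ sym (+[m+1+n]-+n-+1≡+m (deg G v) b) ⟩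
  + (deg G v + 1 + b) - + b - + 1    ≡⟨ cong (λ k → + (k + 1 + b) - + b - + 1) (sym (s-pendant G pendant vu)) ⟩
  + (s G u + 1 + b) - + b - + 1      ≡⟨ cong (λ k → + k - + b - + 1) (parabolic-pendant G identity pendant) ⟩
  + a - + b - + 1                    ∎)
  where open ≡-Reasoning
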